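{- A classical propositional formula $A$ (regarded as a modal formula without $\Box$) is contingent if and only if $A$ is nontrifling, i.e. $\mathsf{GL}_\omega\nvdash\Box\Box A\to\Box A$.
   Context: A propositional formula is contingent if it is neither a tautology nor unsatisfiable. Modal formulas add the unary operator $\Box$; $\Diamond^n A=\neg\Box^n\neg A$ with $\Box^0A=A$, $\Box^{n+1}A=\Box\Box^nA$. $\mathsf{GL}$ has axioms all tautologies, $\Box(p\to q)\to(\Box p\to\Box q)$, $\Box(\Box p\to p)\to\Box p$, and rules modus ponens, necessitation, uniform substitution. $\mathsf{GL}_\omega$ is the logic whose axioms are all theorems of $\mathsf{GL}$ and all formulas $\Diamond^n\top$ ($n\in\omega$), with rules modus ponens and uniform substitution. -}

module Defs where

open import Data.Nat using (ℕ; zero; suc)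
open import Data.Bool using (Bool; true; false; not; _∧_; _∨_)
open import Data.Product using (_×_)
open import Relation.Binary.PropositionalEquality using (_≡_)
open import Relation.Nullary using (¬_)

data Fm : Set where
  var  : ℕ → Fm
  ⊥'   : Fm
  _⇒_  : Fm → Fm → Fm
  □_   : Fm → Fm

infixr 5 _⇒_
infix 7 □_

¬'_ : Fm → Fm
¬' A = A ⇒ ⊥'

⊤' : Fm
⊤' = ¬' ⊥'

□^ : ℕ → Fm → Fm
□^ zero A = A
□^ (suc n) A = □ (□^ n A)

◇^ : ℕ → Fm → Fm
◇^ n A = ¬' (□^ n (¬' A))

data BoxFree : Fm → Set where
  bf-var : ∀ n → BoxFree (var n)
  bf-⊥   : BoxFree ⊥'
  bf-⇒   : ∀ {A B} → BoxFree A → BoxFree B → BoxFree (A ⇒ B)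

-- Boolean evaluation; boxed subformulas □B are treated as propositional
-- atoms whose truth values are given by the second argument.
eval : (ℕ → Bool) → (Fm → Bool) → Fm → Bool
eval v b (var n) = v n
eval v b ⊥' = false
eval v b (A ⇒ B) = not (eval v b A) ∨ eval v b B
eval v b (□ A) = b A

-- Tautology (in the modal language: a substitution instance of a
-- propositional tautology, i.e. true under every Boolean valuation of
-- the variables and of the boxed subformulas).
Tautology : Fm → Set
Tautology A = ∀ v b → eval v b A ≡ true

Unsatisfiable : Fm → Set
Unsatisfiable A = ∀ v b → eval v b A ≡ false

Contingent : Fm → Set
Contingent A = ¬ Tautology A × ¬ Unsatisfiable A

subst' : (ℕ → Fm) → Fm → Fm
subst' σ (var n) = σ n
subst' σ ⊥' = ⊥'
subst' σ (A ⇒ B) = subst' σ A ⇒ subst' σ B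
subst' σ (□ A) = □ (subst' σ A)

p q : Fm
p = var 0
q = var 1

data GL⊢_ : Fm → Set where
  taut : ∀ {A} → Tautology A → GL⊢ A
  axK  : GL⊢ (□ (p ⇒ q) ⇒ (□ p ⇒ □ q))
  axL  : GL⊢ (□ (□ p ⇒ p) ⇒ □ p)
  mp   : ∀ {A B} → GL⊢ (A ⇒ B) → GL⊢ A → GL⊢ B
  nec  : ∀ {A} → GL⊢ A → GL⊢ (□ A)
  us   : ∀ {A} (σ : ℕ → Fm) → GL⊢ A → GL⊢ (subst' σ A)

data GLω⊢_ : Fm → Set where
  gl   : ∀ {A} → GL⊢ A → GLω⊢ A
  dia  : ∀ n → GLω⊢ (◇^ n ⊤')
  mp   : ∀ {A B} → GLω⊢ (A ⇒ B) → GLω⊢ A → GLω⊢ B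
  us   : ∀ {A} (σ : ℕ → Fm) → GLω⊢ A → GLω⊢ (subst' σ A)

Nontrifling : Fm → Set
Nontrifling A = ¬ (GLω⊢ (□ □ A ⇒ □ A))

module Submission where

open import Defs
open import Data.Bool using (Bool; true; false; not; _∧_; _∨_; if_then_else_)
open import Data.Bool.Properties using (¬-not)
open import Data.Empty using (⊥)
open import Data.Nat using (ℕ; zero; suc; _<_; _≤_; _⊔_; _<?_)
open import Data.Nat.Induction using (<-rec)
open import Data.Nat.Properties
  using (≤-refl; ≤-trans; <-trans; <-≤-trans; <-irrefl; ≤-pred; n≤1+n; m<1+n⇒m<n∨m≡n; m≤m⊔n; m≤n⊔m)
open import Data.Product using (_×_; _,_; Σ)
open import Data.Sum using (_⊎_; inj₁; inj₂; [_,_])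
open import Relation.Binary.PropositionalEquality using (_≡_; refl; sym; trans; cong₂)
open import Relation.Nullary using (¬_)
open import Relation.Nullary.Decidable using (does; dec-true; dec-false)

-- Soundness of GL_ω for the frame (ℕ, >) says that every theorem of GL_ω holds at all
-- sufficiently deep worlds, since ◇ⁿ⊤ holds at every world of depth ≥ n.  If a box-free A
-- is false under v₁ and true under v₂, the valuation that is v₂ below N and v₁ at N
-- makes □□A true and □A false at world N + 1, for every N; so □□A → □A is not a theorem.
-- Conversely, if A is a tautology then GL ⊢ □A, and if A is unsatisfiable then
-- GL ⊢ □□A → □□⊥, which together with the axiom ◇²⊤ gives □□A → □A.

false≢true : ¬ (false ≡ true)
false≢true ()

⇒ᵇ-intro : ∀ a b → (a ≡ true → b ≡ true) → not a ∨ b ≡ true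
⇒ᵇ-intro true  b h = h refl
⇒ᵇ-intro false b h = refl

⇒ᵇ-elim : ∀ {a b} → not a ∨ b ≡ true → a ≡ true → b ≡ true
⇒ᵇ-elim ab refl = ab

allBelow : ℕ → (ℕ → Bool) → Bool
allBelow zero    f = true
allBelow (suc n) f = f n ∧ allBelow n f

allBelow-intro : ∀ n {f} → (∀ m → m < n → f m ≡ true) → allBelow n f ≡ true
allBelow-intro zero    h = refl
allBelow-intro (suc n) h
  rewrite h n ≤-refl = allBelow-intro n (λ m m<n → h m (≤-trans m<n (n≤1+n n)))

allBelow-elim : ∀ n {f} → allBelow n f ≡ true → ∀ m → m < n → f m ≡ true
allBelow-elim (suc n) {f} all m m<1+n with f n in fn | m<1+n⇒m<n∨m≡n m<1+n
... | true | inj₁ m<n  = allBelow-elim n all m m<n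
... | true | inj₂ refl = fn

allBelow-false : ∀ n {f m} → m < n → f m ≡ false → allBelow n f ≡ false
allBelow-false n {m = m} m<n fm = ¬-not λ all → false≢true (trans (sym fm) (allBelow-elim n all m m<n))

allBelow-cong : ∀ n {f g} → (∀ m → f m ≡ g m) → allBelow n f ≡ allBelow n g
allBelow-cong zero    f≡g = refl
allBelow-cong (suc n) f≡g = cong₂ _∧_ (f≡g n) (allBelow-cong n f≡g)

Valuation : Set
Valuation = ℕ → ℕ → Bool

sat : Valuation → ℕ → Fm → Bool
sat V w (var n) = V w n
sat V w ⊥'      = false
sat V w (A ⇒ B) = not (sat V w A) ∨ sat V w B
sat V w (□ A)   = allBelow w (λ m → sat V m A)

sat≡eval : ∀ V w A → sat V w A ≡ eval (V w) (λ B → sat V w (□ B)) A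
sat≡eval V w (var n) = refl
sat≡eval V w ⊥'      = refl
sat≡eval V w (A ⇒ B) = cong₂ (λ x y → not x ∨ y) (sat≡eval V w A) (sat≡eval V w B)
sat≡eval V w (□ A)   = refl

sat-subst' : ∀ σ V w A → sat V w (subst' σ A) ≡ sat (λ u n → sat V u (σ n)) w A
sat-subst' σ V w (var n) = refl
sat-subst' σ V w ⊥'      = refl
sat-subst' σ V w (A ⇒ B) = cong₂ (λ x y → not x ∨ y) (sat-subst' σ V w A) (sat-subst' σ V w B)
sat-subst' σ V w (□ A)   = allBelow-cong w (λ m → sat-subst' σ V m A)

Valid : Fm → Set
Valid A = ∀ V w → sat V w A ≡ true

löb-induction : ∀ (f : ℕ → Bool) w → (∀ m → m < w → allBelow m f ≡ true → f m ≡ true) →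
                ∀ m → m < w → f m ≡ true
löb-induction f w step = <-rec (λ m → m < w → f m ≡ true) λ m ih m<w →
  step m m<w (allBelow-intro m λ k k<m → ih k<m (<-trans k<m m<w))

GL-sound : ∀ {A} → GL⊢ A → Valid A
GL-sound {A} (taut t) V w = trans (sat≡eval V w A) (t (V w) _)
GL-sound axK V w = ⇒ᵇ-intro _ _ λ □p⇒q → ⇒ᵇ-intro _ _ λ □p →
  allBelow-intro w λ m m<w → ⇒ᵇ-elim (allBelow-elim w □p⇒q m m<w) (allBelow-elim w □p m m<w)
GL-sound axL V w = ⇒ᵇ-intro _ _ λ □[□p⇒p] →
  allBelow-intro w (löb-induction (λ m → V m 0) w λ m m<w → ⇒ᵇ-elim (allBelow-elim w □[□p⇒p] m m<w))
GL-sound (mp ⊢A⇒B ⊢A) V w = ⇒ᵇ-elim (GL-sound ⊢A⇒B V w) (GL-sound ⊢A V w)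
GL-sound (nec ⊢A) V w = allBelow-intro w λ m _ → GL-sound ⊢A V m
GL-sound (us {A} σ ⊢A) V w = trans (sat-subst' σ V w A) (GL-sound ⊢A _ w)

EventuallyValid : Fm → Set
EventuallyValid A = Σ ℕ λ N → ∀ V w → N ≤ w → sat V w A ≡ true

sat-□^-falsum : ∀ n V w → n ≤ w → sat V w (□^ n (¬' ⊤')) ≡ false
sat-□^-falsum zero    V w _     = refl
sat-□^-falsum (suc n) V w n<w = allBelow-false w n<w (sat-□^-falsum n V n ≤-refl)

GLω-sound : ∀ {A} → GLω⊢ A → EventuallyValid A
GLω-sound (gl ⊢A) = 0 , λ V w _ → GL-sound ⊢A V w
GLω-sound (dia n) = n , λ V w n≤w → cong₂ (λ x y → not x ∨ y) (sat-□^-falsum n V w n≤w) refl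
GLω-sound (mp ⊢A⇒B ⊢A) with GLω-sound ⊢A⇒B | GLω-sound ⊢A
... | N₁ , valid₁ | N₂ , valid₂ = N₁ ⊔ N₂ , λ V w N≤w →
  ⇒ᵇ-elim (valid₁ V w (≤-trans (m≤m⊔n N₁ N₂) N≤w)) (valid₂ V w (≤-trans (m≤n⊔m N₁ N₂) N≤w))
GLω-sound (us {A} σ ⊢A) with GLω-sound ⊢A
... | N , valid = N , λ V w N≤w → trans (sat-subst' σ V w A) (valid _ w N≤w)

eval-boxFree : ∀ {A} → BoxFree A → ∀ v b b′ → eval v b A ≡ eval v b′ A
eval-boxFree (bf-var n)  v b b′ = refl
eval-boxFree bf-⊥        v b b′ = refl
eval-boxFree (bf-⇒ A B) v b b′ = cong₂ (λ x y → not x ∨ y) (eval-boxFree A v b b′) (eval-boxFree B v b b′)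

sat-boxFree : ∀ {A} → BoxFree A → ∀ V w b → sat V w A ≡ eval (V w) b A
sat-boxFree {A} bf V w b = trans (sat≡eval V w A) (eval-boxFree bf (V w) _ b)

staircase : ℕ → (ℕ → Bool) → (ℕ → Bool) → Valuation
staircase N v₁ v₂ k = if does (k <? N) then v₂ else v₁

staircase-refutes-□□⇒□ : ∀ {A v₁ v₂ b} → BoxFree A → eval v₁ b A ≡ false → eval v₂ b A ≡ true →
  ∀ N → sat (staircase N v₁ v₂) (suc N) (□ □ A ⇒ □ A) ≡ false
staircase-refutes-□□⇒□ {A} {v₁} {v₂} {b} bf A₁ A₂ N =
  cong₂ (λ x y → not x ∨ y)
    (allBelow-intro (suc N) λ m m<1+N → allBelow-intro m λ k k<m → true-below (<-≤-trans k<m (≤-pred m<1+N)))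
    (allBelow-false (suc N) ≤-refl false-at-N)
  where
  V : Valuation
  V = staircase N v₁ v₂
  true-below : ∀ {k} → k < N → sat V k A ≡ true
  true-below {k} k<N rewrite sat-boxFree bf V k b | dec-true (k <? N) k<N = A₂
  false-at-N : sat V N A ≡ false
  false-at-N rewrite sat-boxFree bf V N b | dec-false (N <? N) (<-irrefl refl) = A₁

Constant : Fm → Set
Constant A = ∀ v₁ v₂ b → eval v₁ b A ≡ false → eval v₂ b A ≡ true → ⊥

trifling⇒constant : ∀ {A} → BoxFree A → GLω⊢ (□ □ A ⇒ □ A) → Constant A
trifling⇒constant bf ⊢□□A⇒□A _ _ _ A₁ A₂ with GLω-sound ⊢□□A⇒□A
... | N , valid = false≢true (trans (sym (staircase-refutes-□□⇒□ bf A₁ A₂ N)) (valid _ (suc N) (n≤1+n N)))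

constant⇒tautology⊎unsatisfiable : ∀ {A} → BoxFree A → Constant A → Tautology A ⊎ Unsatisfiable A
constant⇒tautology⊎unsatisfiable {A} bf constant with eval (λ _ → false) (λ _ → false) A in A₀
... | true  = inj₁ λ v b → trans (eval-boxFree bf v b _) (¬-not λ A₁ → constant v _ _ A₁ A₀)
... | false = inj₂ λ v b → trans (eval-boxFree bf v b _) (¬-not λ A₂ → constant _ v _ A₀ A₂)

contingent⇒nontrifling : ∀ {A} → BoxFree A → Contingent A → Nontrifling A
contingent⇒nontrifling bf (¬taut , ¬unsat) ⊢□□A⇒□A =
  [ ¬taut , ¬unsat ] (constant⇒tautology⊎unsatisfiable bf (trifling⇒constant bf ⊢□□A⇒□A))

tautology-K : ∀ X Y → Tautology (Y ⇒ (X ⇒ Y))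
tautology-K X Y v b with eval v b X | eval v b Y
... | true  | true  = refl
... | false | true  = refl
... | _     | false = refl

tautology-ex-falso : ∀ X Y Z → Tautology ((X ⇒ Y) ⇒ (¬' Y ⇒ (X ⇒ Z)))
tautology-ex-falso X Y Z v b with eval v b X | eval v b Y
... | true  | true  = refl
... | true  | false = refl
... | false | true  = refl
... | false | false = refl

unsatisfiable⇒tautology-⇒ : ∀ A B → Unsatisfiable A → Tautology (A ⇒ B)
unsatisfiable⇒tautology-⇒ A B unsat v b rewrite unsat v b = refl

GL-□-mono : ∀ {A B} → GL⊢ (A ⇒ B) → GL⊢ (□ A ⇒ □ B)
GL-□-mono {A} {B} ⊢A⇒B = mp (us σ axK) (nec ⊢A⇒B)
  where
  σ : ℕ → Fm
  σ zero          = A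
  σ (suc zero)    = B
  σ (suc (suc n)) = var (suc (suc n))

tautology⇒trifling : ∀ {A} → Tautology A → GLω⊢ (□ □ A ⇒ □ A)
tautology⇒trifling {A} taut-A = gl (mp (taut (tautology-K (□ □ A) (□ A))) (nec (taut taut-A)))

unsatisfiable⇒trifling : ∀ {A} → Unsatisfiable A → GLω⊢ (□ □ A ⇒ □ A)
unsatisfiable⇒trifling {A} unsat =
  mp (mp (gl (taut (tautology-ex-falso (□ □ A) (□ □ (¬' ⊤')) (□ A))))
         (gl (GL-□-mono (GL-□-mono (taut (unsatisfiable⇒tautology-⇒ A (¬' ⊤') unsat))))))
     (dia 2)

nontrifling⇒contingent : ∀ {A} → Nontrifling A → Contingent A
nontrifling⇒contingent nontrifling =
  (λ taut-A → nontrifling (tautology⇒trifling taut-A)) , (λ unsat → nontrifling (unsatisfiable⇒trifling unsat))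

proposition3p13 : (A : Fm) → BoxFree A →
    (Contingent A → Nontrifling A) × (Nontrifling A → Contingent A)
proposition3p13 A bf = contingent⇒nontrifling bf , nontrifling⇒contingent
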